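{- Let $\pi=\pi_1\cdots\pi_n\in\mathfrak S_n$ and write $\pi=\pi^{(1)}\pi'$ where $\pi^{(1)}=\pi_1\cdots\pi_{i_\pi}$ is a permutation of $\{1,\dots,i_\pi\}$ and $\pi'=\pi_{i_\pi+1}\cdots\pi_n$. Then $\pi$ is a $1234$-avoiding decomposable permutation if and only if one of the following two conditions holds: (i) $\pi^{(1)}=i_\pi(i_\pi-1)\cdots1$, $\pi'$ is $123$-avoiding, and $1\le i_\pi\le n-1$; or (ii) $\pi^{(1)}\ne i_\pi(i_\pi-1)\cdots1$, $\pi^{(1)}$ is $123$-avoiding, $\pi'=n(n-1)\cdots(i_\pi+1)$, and $3\le i_\pi\le n-1$.
   Context: For a permutation $\pi=\pi_1\cdots\pi_n$ of $[n]$, $i_\pi$ is the smallest index $i$ with $\{\pi_1,\dots,\pi_i\}=\{1,\dots,i\}$; $\pi$ is indecomposable if $i_\pi=n$ and decomposable otherwise. A permutation (or sequence of distinct integers) avoids $12\cdots k$ if it has no increasing subsequence of length $k$. -}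

module Defs where

open import Data.Nat using (ℕ; suc; _+_; _∸_; _≤_; _<_)
open import Data.List using (List; map; upTo; downFrom; take; length)
open import Data.List.Relation.Binary.Permutation.Propositional using (_↭_)
open import Data.List.Relation.Binary.Sublist.Propositional using (_⊆_)
open import Data.List.Relation.Unary.Linked using (Linked)
open import Data.Product using (_×_)
open import Relation.Binary.PropositionalEquality using (_≡_)
open import Relation.Nullary using (¬_)

range1 : ℕ → List ℕ
range1 n = map suc (upTo n)

IsPerm : ℕ → List ℕ → Set
IsPerm n π = π ↭ range1 n

InitialBlock : List ℕ → ℕ → Set
InitialBlock π i = take i π ↭ range1 i

IsIndexOf : List ℕ → ℕ → Set
IsIndexOf π i = (1 ≤ i) × InitialBlock π i
              × (∀ j → 1 ≤ j → j < i → ¬ InitialBlock π j)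

Decomposable : ℕ → List ℕ → ℕ → Set
Decomposable n π i = ¬ (i ≡ n)

Increasing : List ℕ → Set
Increasing = Linked _<_

Avoids : ℕ → List ℕ → Set
Avoids k σ = ∀ s → s ⊆ σ → length s ≡ k → ¬ Increasing s

decTo1 : ℕ → List ℕ
decTo1 i = map suc (downFrom i)

decFromTo : ℕ → ℕ → List ℕ
decFromTo n i = map (λ x → suc (i + x)) (downFrom (n ∸ i))

-- Cut π after its first block, π = A ++ B: A is a permutation of 1…i and every entry of B
-- exceeds every entry of A. Increasing subsequences of A and of B therefore concatenate, so π
-- contains 12⋯(k+l) as soon as A contains 12⋯k and B contains 12⋯l; conversely an increasing
-- subsequence of π splits at the cut, so if A avoids 12⋯(a+1) and B avoids 12⋯(b+1) then π
-- avoids 12⋯(a+b+1). For 1234 this leaves two shapes: A without an ascent (A = i⋯1) and B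
-- avoiding 123, or A with an ascent, B without one (B = n⋯i+1) and A avoiding 123. An ascent
-- in A forces i ≥ 3, since a first block 12 would have the shorter first block 1.
module Submission where

open import Defs
open import Data.Nat using (ℕ; zero; suc; _+_; _∸_; _⊓_; _≤_; _<_; _≥_; z≤n; s≤s; _<?_)
open import Data.Nat.Properties
open import Data.List using (List; []; _∷_; _++_; take; drop; map; length; upTo; downFrom; reverse)
open import Data.List.Properties
  using (take++drop≡id; take-take; length-take; length-drop; length-map; length-upTo; length-++; reverse-upTo)
open import Data.List.Relation.Unary.All as All using (All; []; _∷_)
import Data.List.Relation.Unary.All.Properties as All
open import Data.List.Relation.Unary.AllPairs using (AllPairs; []; _∷_)
open import Data.List.Relation.Unary.Linked as Linked using (Linked; []; [-]; _∷_)
import Data.List.Relation.Unary.Linked.Properties as Linked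
open import Data.List.Relation.Binary.Sublist.Propositional using (_⊆_; []; _∷_; _∷ʳ_; ⊆-trans)
import Data.List.Relation.Binary.Sublist.Propositional.Properties as Sublist
open import Data.List.Relation.Binary.Permutation.Propositional
  using (_↭_; ↭-sym; ↭-trans; ↭-reflexive; ↭⇒↭ₛ; module PermutationReasoning)
import Data.List.Relation.Binary.Permutation.Propositional.Properties as Perm
open import Data.List.Relation.Binary.Equality.Propositional using (≋⇒≡)
open import Data.List.Relation.Unary.Sorted.TotalOrder.Properties using (↗↭↗⇒≋)
open import Data.Product using (_×_; _,_; ∃-syntax; ∃₂)
open import Data.Sum using (_⊎_; inj₁; inj₂)
open import Data.Empty using (⊥-elim)
open import Function using (id)
open import Function.Bundles using (_⇔_; mk⇔)
open import Relation.Binary.Structures using (IsTotalOrder)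
import Relation.Binary.Properties.TotalOrder as TotalOrderProperties
open import Relation.Binary.PropositionalEquality
  using (_≡_; refl; sym; trans; cong; subst; module ≡-Reasoning)
open import Relation.Nullary using (¬_; yes; no)

NonIncreasing : List ℕ → Set
NonIncreasing = Linked _≥_

Contains : ℕ → List ℕ → Set
Contains k σ = ∃[ s ] s ⊆ σ × length s ≡ k × Increasing s

Below : List ℕ → List ℕ → Set
Below xs ys = All (λ x → All (x <_) ys) xs

contains⇒¬avoids : ∀ {k σ} → Contains k σ → ¬ Avoids k σ
contains⇒¬avoids (s , s⊆σ , |s|≡k , s↗) avoids = avoids s s⊆σ |s|≡k s↗

m+n≡1+a+b⇒a<m⊎b<n : ∀ {m n} a b → m + n ≡ suc (a + b) → a < m ⊎ b < n
m+n≡1+a+b⇒a<m⊎b<n {m} {n} a b eq with a <? m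
... | yes a<m = inj₁ a<m
... | no a≮m = inj₂ (+-cancelˡ-≤ a (suc b) n (begin
  a + suc b    ≡⟨ +-suc a b ⟩
  suc (a + b)  ≡⟨ sym eq ⟩
  m + n        ≤⟨ +-monoˡ-≤ n (≮⇒≥ a≮m) ⟩
  a + n        ∎))
  where open ≤-Reasoning

length-take-≤ : ∀ i (xs : List ℕ) → length (take i xs) ≤ i
length-take-≤ i xs = subst (_≤ i) (sym (length-take i xs)) (m⊓n≤m i (length xs))

⊆-++⁻ : ∀ {s} xs {ys : List ℕ} → s ⊆ xs ++ ys → ∃₂ λ s₁ s₂ → s ≡ s₁ ++ s₂ × s₁ ⊆ xs × s₂ ⊆ ys
⊆-++⁻ [] s⊆ys = [] , _ , refl , [] , s⊆ys
⊆-++⁻ (x ∷ xs) (.x ∷ʳ s⊆) with ⊆-++⁻ xs s⊆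
... | s₁ , s₂ , eq , s₁⊆ , s₂⊆ = s₁ , s₂ , eq , x ∷ʳ s₁⊆ , s₂⊆
⊆-++⁻ (x ∷ xs) (refl ∷ s⊆) with ⊆-++⁻ xs s⊆
... | s₁ , s₂ , refl , s₁⊆ , s₂⊆ = x ∷ s₁ , s₂ , refl , refl ∷ s₁⊆ , s₂⊆

AllPairs-resp-⊆ : ∀ {R : ℕ → ℕ → Set} {s xs} → s ⊆ xs → AllPairs R xs → AllPairs R s
AllPairs-resp-⊆ [] [] = []
AllPairs-resp-⊆ (_ ∷ʳ s⊆) (_ ∷ rxs) = AllPairs-resp-⊆ s⊆ rxs
AllPairs-resp-⊆ (refl ∷ s⊆) (rx ∷ rxs) = Sublist.All-resp-⊆ s⊆ rx ∷ AllPairs-resp-⊆ s⊆ rxs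

module _ {R : ℕ → ℕ → Set} where

  Linked-++⁻ˡ : ∀ xs {ys} → Linked R (xs ++ ys) → Linked R xs
  Linked-++⁻ˡ [] _ = []
  Linked-++⁻ˡ (x ∷ []) _ = [-]
  Linked-++⁻ˡ (x ∷ y ∷ xs) (rxy ∷ r) = rxy ∷ Linked-++⁻ˡ (y ∷ xs) r

  Linked-++⁻ʳ : ∀ xs {ys} → Linked R (xs ++ ys) → Linked R ys
  Linked-++⁻ʳ [] r = r
  Linked-++⁻ʳ (x ∷ xs) r = Linked-++⁻ʳ xs (Linked.tail r)

  Linked-++⁺ : ∀ {xs ys} → All (λ x → All (R x) ys) xs →
               Linked R xs → Linked R ys → Linked R (xs ++ ys)
  Linked-++⁺ [] [] rys = rys
  Linked-++⁺ {ys = []} (_ ∷ []) [-] [] = [-]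
  Linked-++⁺ {ys = y ∷ ys} ((rxy ∷ _) ∷ []) [-] rys = rxy ∷ rys
  Linked-++⁺ (_ ∷ rxsys) (rxy ∷ rxs) rys = rxy ∷ Linked-++⁺ rxsys rxs rys

sorted↭sorted⇒≡ : ∀ {R : ℕ → ℕ → Set} → IsTotalOrder _≡_ R →
                  ∀ {xs ys} → Linked R xs → Linked R ys → xs ↭ ys → xs ≡ ys
sorted↭sorted⇒≡ isTotalOrder xs↗ ys↗ xs↭ys =
  ≋⇒≡ (↗↭↗⇒≋ (record { isTotalOrder = isTotalOrder }) xs↗ ys↗ (↭⇒↭ₛ xs↭ys))

nonIncreasing↭⇒≡ : ∀ {xs ys} → NonIncreasing xs → NonIncreasing ys → xs ↭ ys → xs ≡ ys
nonIncreasing↭⇒≡ = sorted↭sorted⇒≡ (TotalOrderProperties.≥-isTotalOrder ≤-totalOrder)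

++-cancelˡ-↭ : ∀ (xs : List ℕ) {ys zs} → xs ++ ys ↭ xs ++ zs → ys ↭ zs
++-cancelˡ-↭ [] p = p
++-cancelˡ-↭ (x ∷ xs) p = ++-cancelˡ-↭ xs (Perm.drop-∷ p)

contains-≤ : ∀ {k m σ} → k ≤ m → Contains m σ → Contains k σ
contains-≤ {k} k≤m (s , s⊆σ , refl , s↗) =
  take k s , ⊆-trans (Sublist.take-⊆ k s) s⊆σ , trans (length-take k s) (m≤n⇒m⊓n≡m k≤m) ,
  Linked-++⁻ˡ (take k s) (subst Increasing (sym (take++drop≡id k s)) s↗)

contains⇒≤length : ∀ {k σ} → Contains k σ → k ≤ length σ
contains⇒≤length (s , s⊆σ , refl , _) = Sublist.length-mono-≤ s⊆σ

nonempty⇒contains1 : ∀ {σ} → 1 ≤ length σ → Contains 1 σ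
nonempty⇒contains1 {x ∷ σ} _ = x ∷ [] , refl ∷ Sublist.[]⊆-universal σ , refl , [-]

nonIncreasing⇒avoids2 : ∀ {σ} → NonIncreasing σ → Avoids 2 σ
nonIncreasing⇒avoids2 σ↘ [] _ ()
nonIncreasing⇒avoids2 σ↘ (_ ∷ []) _ ()
nonIncreasing⇒avoids2 σ↘ (_ ∷ _ ∷ _ ∷ _) _ ()
nonIncreasing⇒avoids2 σ↘ (x ∷ y ∷ []) s⊆σ refl (x<y ∷ [-])
  with AllPairs-resp-⊆ s⊆σ (Linked.Linked⇒AllPairs (λ z≤y y≤x → ≤-trans y≤x z≤y) σ↘)
... | (y≤x ∷ []) ∷ _ = <⇒≱ x<y y≤x

nonIncreasing⊎contains2 : ∀ σ → NonIncreasing σ ⊎ Contains 2 σ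
nonIncreasing⊎contains2 [] = inj₁ []
nonIncreasing⊎contains2 (x ∷ []) = inj₁ [-]
nonIncreasing⊎contains2 (x ∷ y ∷ σ) with x <? y | nonIncreasing⊎contains2 (y ∷ σ)
... | yes x<y | _ = inj₂ (x ∷ y ∷ [] , refl ∷ refl ∷ Sublist.[]⊆-universal σ , refl , x<y ∷ [-])
... | no x≮y | inj₁ σ↘ = inj₁ (≮⇒≥ x≮y ∷ σ↘)
... | no _ | inj₂ (s , s⊆ , |s| , s↗) = inj₂ (s , x ∷ʳ s⊆ , |s| , s↗)

contains-++ : ∀ {k l xs ys} → Below xs ys →
              Contains k xs → Contains l ys → Contains (k + l) (xs ++ ys)
contains-++ xs<ys (s₁ , s₁⊆ , refl , s₁↗) (s₂ , s₂⊆ , refl , s₂↗) =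
  s₁ ++ s₂ , Sublist.++⁺ s₁⊆ s₂⊆ , length-++ s₁ ,
  Linked-++⁺ (Sublist.All-resp-⊆ s₁⊆ (All.map (Sublist.All-resp-⊆ s₂⊆) xs<ys)) s₁↗ s₂↗

avoids-++⁻ˡ : ∀ {k l xs ys} → Below xs ys → Contains l ys → Avoids (k + l) (xs ++ ys) → Avoids k xs
avoids-++⁻ˡ xs<ys cys avoids s s⊆ |s| s↗ =
  contains⇒¬avoids (contains-++ xs<ys (s , s⊆ , |s| , s↗) cys) avoids

avoids-++⁻ʳ : ∀ {k l xs ys} → Below xs ys → Contains k xs → Avoids (k + l) (xs ++ ys) → Avoids l ys
avoids-++⁻ʳ xs<ys cxs avoids s s⊆ |s| s↗ =
  contains⇒¬avoids (contains-++ xs<ys cxs (s , s⊆ , |s| , s↗)) avoids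

avoids-++⁺ : ∀ a b {xs ys} → Avoids (suc a) xs → Avoids (suc b) ys → Avoids (suc (a + b)) (xs ++ ys)
avoids-++⁺ a b {xs} avoidsˡ avoidsʳ s s⊆ |s| s↗ with ⊆-++⁻ xs s⊆
... | s₁ , s₂ , refl , s₁⊆ , s₂⊆
  with m+n≡1+a+b⇒a<m⊎b<n a b (trans (sym (length-++ s₁)) |s|)
... | inj₁ a<|s₁| =
  contains⇒¬avoids (contains-≤ a<|s₁| (s₁ , s₁⊆ , refl , Linked-++⁻ˡ s₁ s↗)) avoidsˡ
... | inj₂ b<|s₂| =
  contains⇒¬avoids (contains-≤ b<|s₂| (s₂ , s₂⊆ , refl , Linked-++⁻ʳ s₁ s↗)) avoidsʳ

nonIncreasing-map-downFrom : ∀ (f : ℕ → ℕ) → (∀ x → f x ≤ f (suc x)) →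
                             ∀ k → NonIncreasing (map f (downFrom k))
nonIncreasing-map-downFrom f f-mono k = Linked.map⁺ (Linked.applyDownFrom⁺₂ id k f-mono)

decTo1-nonIncreasing : ∀ i → NonIncreasing (decTo1 i)
decTo1-nonIncreasing = nonIncreasing-map-downFrom suc (λ x → n≤1+n (suc x))

decFromTo-nonIncreasing : ∀ n i → NonIncreasing (decFromTo n i)
decFromTo-nonIncreasing n i =
  nonIncreasing-map-downFrom (λ x → suc (i + x)) (λ x → s≤s (+-monoʳ-≤ i (n≤1+n x))) (n ∸ i)

decTo1-avoids2 : ∀ i → Avoids 2 (decTo1 i)
decTo1-avoids2 i = nonIncreasing⇒avoids2 (decTo1-nonIncreasing i)

decFromTo-avoids2 : ∀ n i → Avoids 2 (decFromTo n i)
decFromTo-avoids2 n i = nonIncreasing⇒avoids2 (decFromTo-nonIncreasing n i)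

decTo1-≤ : ∀ i → All (_≤ i) (decTo1 i)
decTo1-≤ i = All.map⁺ (All.applyDownFrom⁺₁ id i id)

decFromTo-> : ∀ n i → All (i <_) (decFromTo n i)
decFromTo-> n i = All.map⁺ (All.applyDownFrom⁺₂ id (n ∸ i) (λ x → s≤s (m≤m+n i x)))

range1↭decTo1 : ∀ n → range1 n ↭ decTo1 n
range1↭decTo1 n = begin
  map suc (upTo n)            ↭⟨ Perm.map⁺ suc (↭-sym (Perm.↭-reverse (upTo n))) ⟩
  map suc (reverse (upTo n))  ≡⟨ cong (map suc) (reverse-upTo n) ⟩
  decTo1 n                    ∎
  where open PermutationReasoning

length-range1 : ∀ n → length (range1 n) ≡ n
length-range1 n = trans (length-map suc (upTo n)) (length-upTo n)

decTo1-+ : ∀ i k → decTo1 (i + k) ≡ map (λ x → suc (i + x)) (downFrom k) ++ decTo1 i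
decTo1-+ i zero rewrite +-identityʳ i = refl
decTo1-+ i (suc k) rewrite +-suc i k = cong (suc (i + k) ∷_) (decTo1-+ i k)

decTo1-split : ∀ {n i} → i ≤ n → decTo1 n ≡ decFromTo n i ++ decTo1 i
decTo1-split {n} {i} i≤n =
  subst (λ m → decTo1 m ≡ decFromTo n i ++ decTo1 i) (m+[n∸m]≡n i≤n) (decTo1-+ i (n ∸ i))

module FirstBlock {n π i} (π-perm : IsPerm n π) (block : InitialBlock π i) where

  first rest : List ℕ
  first = take i π
  rest = drop i π

  first++rest≡π : first ++ rest ≡ π
  first++rest≡π = take++drop≡id i π

  first↭decTo1 : first ↭ decTo1 i
  first↭decTo1 = ↭-trans block (range1↭decTo1 i)

  length-π : length π ≡ n
  length-π = trans (Perm.↭-length π-perm) (length-range1 n)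

  length-first : length first ≡ i
  length-first = trans (Perm.↭-length block) (length-range1 i)

  i≤n : i ≤ n
  i≤n = m⊓n≡m⇒m≤n (begin
    i ⊓ n               ≡⟨ cong (i ⊓_) (sym length-π) ⟩
    i ⊓ length π        ≡⟨ sym (length-take i π) ⟩
    length first        ≡⟨ length-first ⟩
    i                   ∎)
    where open ≡-Reasoning

  rest↭decFromTo : rest ↭ decFromTo n i
  rest↭decFromTo = ++-cancelˡ-↭ (decTo1 i) (begin
    decTo1 i ++ rest           ↭⟨ Perm.++⁺ʳ rest (↭-sym first↭decTo1) ⟩
    first ++ rest              ≡⟨ first++rest≡π ⟩
    π                          ↭⟨ π-perm ⟩
    range1 n                   ↭⟨ range1↭decTo1 n ⟩
    decTo1 n                   ≡⟨ decTo1-split i≤n ⟩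
    decFromTo n i ++ decTo1 i  ↭⟨ Perm.++-comm (decFromTo n i) (decTo1 i) ⟩
    decTo1 i ++ decFromTo n i  ∎)
    where open PermutationReasoning

  first<rest : Below first rest
  first<rest = All.map (λ a≤i → All.map (≤-<-trans a≤i) rest>i) first≤i
    where
    first≤i : All (_≤ i) first
    first≤i = Perm.All-resp-↭ (↭-sym first↭decTo1) (decTo1-≤ i)
    rest>i : All (i <_) rest
    rest>i = Perm.All-resp-↭ (↭-sym rest↭decFromTo) (decFromTo-> n i)

  length-rest : length rest ≡ n ∸ i
  length-rest = trans (length-drop i π) (cong (_∸ i) length-π)

  first-contains1 : 1 ≤ i → Contains 1 first
  first-contains1 1≤i = nonempty⇒contains1 (subst (1 ≤_) (sym length-first) 1≤i)

  rest-contains1 : i < n → Contains 1 rest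
  rest-contains1 i<n = nonempty⇒contains1 (subst (1 ≤_) (sym length-rest) (m<n⇒0<n∸m i<n))

  ascent⇒rest≡decFromTo : Avoids 4 (first ++ rest) → Contains 2 first → rest ≡ decFromTo n i
  ascent⇒rest≡decFromTo avoids ascentˡ with nonIncreasing⊎contains2 rest
  ... | inj₁ rest↘ = nonIncreasing↭⇒≡ rest↘ (decFromTo-nonIncreasing n i) rest↭decFromTo
  ... | inj₂ ascentʳ = ⊥-elim (contains⇒¬avoids (contains-++ first<rest ascentˡ ascentʳ) avoids)

contains2⇒3≤index : ∀ {π i} → IsIndexOf π i → Contains 2 (take i π) → 3 ≤ i
contains2⇒3≤index {π} {0} _ ascent with () ← ≤-trans (contains⇒≤length ascent) (length-take-≤ 0 π)
contains2⇒3≤index {π} {1} _ ascent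
  with s≤s () ← ≤-trans (contains⇒≤length ascent) (length-take-≤ 1 π)
contains2⇒3≤index {π} {2} (_ , block , minimal) (s , s⊆ , |s| , s↗) =
  ⊥-elim (minimal 1 ≤-refl ≤-refl (↭-reflexive take1≡1))
  where
  s≡take2 : s ≡ take 2 π
  s≡take2 = ≋⇒≡ (Sublist.to-≋ (trans |s| (sym (trans (Perm.↭-length block) (length-range1 2)))) s⊆)
  take2≡12 : take 2 π ≡ range1 2
  take2≡12 = sorted↭sorted⇒≡ ≤-isTotalOrder
    (subst (Linked _≤_) s≡take2 (Linked.map <⇒≤ s↗)) (s≤s z≤n ∷ [-]) block
  take1≡1 : take 1 π ≡ range1 1
  take1≡1 = trans (sym (take-take 1 2 π)) (cong (take 1) take2≡12)
contains2⇒3≤index {i = suc (suc (suc _))} _ _ = s≤s (s≤s (s≤s z≤n))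

lemma3p18 : (n : ℕ) → 1 ≤ n → (π : List ℕ) → IsPerm n π → (i : ℕ) → IsIndexOf π i →
    ((Avoids 4 π × Decomposable n π i)
      ⇔ ((take i π ≡ decTo1 i × Avoids 3 (drop i π) × 1 ≤ i × i ≤ n ∸ 1)
         ⊎ (¬ (take i π ≡ decTo1 i) × Avoids 3 (take i π) × drop i π ≡ decFromTo n i
            × 3 ≤ i × i ≤ n ∸ 1)))
lemma3p18 (suc m) _ π π-perm i index@(1≤i , block , _) = mk⇔ forward backward
  where
  open FirstBlock π-perm block

  FirstDecreasing RestDecreasing : Set
  FirstDecreasing = first ≡ decTo1 i × Avoids 3 rest × 1 ≤ i × i ≤ m
  RestDecreasing = ¬ first ≡ decTo1 i × Avoids 3 first × rest ≡ decFromTo (suc m) i × 3 ≤ i × i ≤ m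

  classify : Avoids 4 (first ++ rest) → i ≤ m → FirstDecreasing ⊎ RestDecreasing
  classify avoids i≤m with nonIncreasing⊎contains2 first
  ... | inj₁ first↘ =
    inj₁ ( nonIncreasing↭⇒≡ first↘ (decTo1-nonIncreasing i) first↭decTo1
         , avoids-++⁻ʳ first<rest (first-contains1 1≤i) avoids , 1≤i , i≤m )
  ... | inj₂ ascent =
    inj₂ ( (λ first≡ → contains⇒¬avoids ascent (subst (Avoids 2) (sym first≡) (decTo1-avoids2 i)))
         , avoids-++⁻ˡ first<rest (rest-contains1 (s≤s i≤m)) avoids
         , ascent⇒rest≡decFromTo avoids ascent , contains2⇒3≤index index ascent , i≤m )

  forward : Avoids 4 π × Decomposable (suc m) π i → FirstDecreasing ⊎ RestDecreasing
  forward (avoids , i≢n) =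
    classify (subst (Avoids 4) (sym first++rest≡π) avoids) (≤-pred (≤∧≢⇒< i≤n i≢n))

  backward : FirstDecreasing ⊎ RestDecreasing → Avoids 4 π × Decomposable (suc m) π i
  backward (inj₁ (first≡ , avoids-rest , _ , i≤m)) =
    subst (Avoids 4) first++rest≡π (avoids-++⁺ 1 2 avoids-first avoids-rest) , <⇒≢ (s≤s i≤m)
    where
    avoids-first : Avoids 2 first
    avoids-first = subst (Avoids 2) (sym first≡) (decTo1-avoids2 i)
  backward (inj₂ (_ , avoids-first , rest≡ , _ , i≤m)) =
    subst (Avoids 4) first++rest≡π (avoids-++⁺ 2 1 avoids-first avoids-rest) , <⇒≢ (s≤s i≤m)
    where
    avoids-rest : Avoids 2 rest
    avoids-rest = subst (Avoids 2) (sym rest≡) (decFromTo-avoids2 (suc m) i)
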